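{- Let $G$ be a finite group and $H$ a subgroup of index $2$ and order $n$. Let $S_1,S_2\subset G\setminus H$ with $S_1\cup S_2=G\setminus H$, $S_1\cap S_2=\emptyset$, $|S_1|=k$, $|S_2|=n-k$, where $0<k<n$. Then: (i) if $\mathcal{G}(G,H,S_1)$ is not connected, then for each $\mu\in\{k,-k\}$ there are linearly independent eigenfunctions $f$ and $g$ of $\mathcal{G}(G,H,S_1)$ with eigenvalue $\mu$ such that $f-g$ is an eigenfunction of $\mathcal{G}(G,H,S_2)$ with eigenvalue $-\mu$; (ii) if $f$ is an eigenfunction of $\mathcal{G}(G,H,S_1)$ with eigenvalue $\mu\neq\pm k$, then $f$ is an eigenfunction of $\mathcal{G}(G,H,S_2)$ with eigenvalue $-\mu$.
   Context: The group-subgroup pair graph $\mathcal{G}(G,H,S)$ (for $S\subset G\setminus H$) is the undirected graph with vertex set $G$ whose edges are exactly the pairs $\{h,hs\}$ with $h\in H$, $s\in S$. An eigenfunction with eigenvalue $\mu$ is a nonzero $f:G\to\mathbb{C}$ with $Af=\mu f$, where $A$ is the adjacency operator: $(Af)(y)=\sum_{s\in S}f(ys)$ for $y\in H$ and $(Af)(y)=\sum_{s\in S}f(ys^{ -1})$ for $y\in G\setminus H$. -}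

module Defs where

open import Level using (Level; _⊔_) renaming (suc to lsuc)
open import Data.Nat using (ℕ; zero; suc)
open import Data.Fin using (Fin; zero; suc)
open import Data.Fin.Subset using (Subset; _∈_)
open import Data.Fin.Subset.Properties using (_∈?_)
open import Data.Bool using (if_then_else_)
open import Data.Product using (Σ; ∃; _×_; _,_)
open import Data.Sum using (_⊎_)
open import Function using (_∘_)
open import Relation.Nullary using (¬_; does)
open import Relation.Binary.PropositionalEquality using (_≡_)
open import Relation.Binary.Construct.Closure.ReflexiveTransitive using (Star)
open import Algebra.Bundles using (CommutativeRing)
open import Algebra.Structures using (IsGroup)

-- Scalars: a field (stdlib has no Field bundle).  The paper uses ℂ,
-- which is an instance of 'Field' satisfying 'CharZero'.

record Field (c ℓ : Level) : Set (lsuc (c ⊔ ℓ)) where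
  field
    commutativeRing : CommutativeRing c ℓ
  open CommutativeRing commutativeRing public
  field
    1≉0     : ¬ (1# ≈ 0#)
    inverse : ∀ x → ¬ (x ≈ 0#) → ∃ λ y → x * y ≈ 1#

module _ {c ℓ} (F : Field c ℓ) where
  open Field F using (Carrier; _≈_; _+_; _*_; 0#; 1#)

  embed : ℕ → Carrier
  embed zero    = 0#
  embed (suc m) = 1# + embed m

  CharZero : Set ℓ
  CharZero = ∀ m → ¬ (embed (suc m) ≈ 0#)

  sumFin : ∀ {n} → (Fin n → Carrier) → Carrier
  sumFin {zero}  f = 0#
  sumFin {suc n} f = f zero + sumFin (f ∘ suc)

record FinGroup : Set where
  infixl 7 _·_
  field
    order   : ℕ
    _·_     : Fin order → Fin order → Fin order
    ε       : Fin order
    _⁻¹     : Fin order → Fin order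
    isGroup : IsGroup _≡_ _·_ ε _⁻¹

module _ (G : FinGroup) where
  open FinGroup G

  IsSubgroup : Subset order → Set
  IsSubgroup H = (ε ∈ H)
               × (∀ x y → x ∈ H → y ∈ H → (x · y) ∈ H)
               × (∀ x → x ∈ H → (x ⁻¹) ∈ H)

  Edge : Subset order → Subset order → Fin order → Fin order → Set
  Edge H S x y = (x ∈ H × Σ (Fin order) λ s → s ∈ S × y ≡ x · s)
               ⊎ (y ∈ H × Σ (Fin order) λ s → s ∈ S × x ≡ y · s)

  Connected : Subset order → Subset order → Set
  Connected H S = ∀ x y → Star (Edge H S) x y

module _ {c ℓ} (F : Field c ℓ) (G : FinGroup) where
  open Field F using (Carrier; _≈_; _+_; _*_; 0#; 1#)
  open FinGroup G

  adj : Subset order → Subset order → (Fin order → Carrier) → Fin order → Carrier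
  adj H S f y =
    if does (y ∈? H)
    then sumFin F (λ s → if does (s ∈? S) then f (y · s) else 0#)
    else sumFin F (λ s → if does (s ∈? S) then f (y · (s ⁻¹)) else 0#)

  IsEigenfunction : Subset order → Subset order → (Fin order → Carrier) → Carrier → Set ℓ
  IsEigenfunction H S f μ =
    ¬ (∀ x → f x ≈ 0#) × (∀ y → adj H S f y ≈ μ * f y)

  LinearlyIndependent₂ : (Fin order → Carrier) → (Fin order → Carrier) → Set (c ⊔ ℓ)
  LinearlyIndependent₂ f g =
    ∀ a b → (∀ x → a * f x + b * g x ≈ 0#) → (a ≈ 0#) × (b ≈ 0#)

-- Write ∑H f and ∑∁H f for the sums of f over the two cosets of H. As H has index two,
-- y ↦ y · s with s ∉ H exchanges the cosets, so on H the adjacency operator of S₁ ∪ S₂ = ∁ H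
-- sends f to the constant ∑∁H f, and off H to ∑H f. Double counting the edges of 𝒢(G,H,S₁)
-- turns A₁ f = μ f into μ ∑H f = k ∑∁H f and μ ∑∁H f = k ∑H f. For μ ≠ ±k both coset sums
-- therefore vanish, and then A₂ f = A_{∁H} f − A₁ f = −μ f: this is (ii).
-- For (i), a union X of components of 𝒢(G,H,S₁) carries the eigenfunction u_X equal to 1 on
-- X ∩ H and to σ = ±1 on X ∖ H, with eigenvalue σk, and double counting gives ∑∁H u_X = σ ∑H u_X.
-- If C is a union of components and C and its complement D are both nonempty, the difference of
-- f = (∑H u_D) u_C and g = (∑H u_C) u_D has both coset sums zero, so it is a (−σk)-eigenfunction
-- of 𝒢(G,H,S₂).

module Submission where

open import Defs
open import Level using (0ℓ; _⊔_)
open import Algebra.Bundles using (Group)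
open import Algebra.Structures using (IsGroup)
open import Data.Nat as ℕ using (ℕ; zero; suc; _<_; s≤s; z≤n)
open import Data.Nat.Properties as ℕ using (<-≤-trans; <-irrefl; m+n∸m≡n)
open import Data.Fin using (Fin)
open import Data.Fin.Properties using (_≟_; any?; all?; ¬∀⟶∃¬)
open import Data.Fin.Subset
  using (Subset; _∈_; _∉_; _⊆_; _⊂_; _∪_; _∩_; ∁; ⊥; ⁅_⁆; ∣_∣; Nonempty; inside; outside)
open import Data.Fin.Subset.Properties
  using (_∈?_; _⊂?_; p⊂q⇒∣p∣<∣q∣; ∣p∣≤n; x∈⁅x⁆; x∈⁅y⁆⇒x≡y;
         x∈∁p⇒x∉p; x∉p⇒x∈∁p; ∣∁p∣≡n∸∣p∣; x∈p⇒∣p-x∣<∣p∣; nonempty?; Empty-unique; ∣⊥∣≡0;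
         ∩⇔×; ∉⊥; x∈p∩q⁺; x∈p∪q⁺; x∈p∪q⁻)
open import Data.Bool using (Bool; true; false; not; _∧_; _xor_; if_then_else_)
open import Data.Bool.Properties using (not-involutive; not-distribʳ-xor; xor-identityʳ)
open import Data.Vec using ([]; _∷_; tabulate)
open import Data.Fin.Permutation using (Permutation; permutation; _⟨$⟩ʳ_)
import Algebra.Properties.CommutativeMonoid.Sum as CommutativeMonoidSum
open import Data.Vec.Properties using ([]=⇒lookup; lookup⇒[]=; lookup∘tabulate)
open import Data.Product using (Σ; ∃; _×_; _,_; proj₁; proj₂)
open import Data.Sum using (_⊎_; inj₁; inj₂; [_,_]′)
open import Data.Empty using (⊥-elim)
open import Function using (_∘_; mk⇔)
open import Relation.Unary as U using (Pred)
open import Relation.Binary using (Rel; Decidable)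
open import Relation.Nullary using (¬_; yes; no; does; ¬?)
open import Relation.Nullary.Decidable
  using (_×-dec_; _⊎-dec_; dec-true; dec-false; does-⇔; decidable-stable; toSum)
open import Relation.Binary.PropositionalEquality as ≡ using (_≡_)
open import Relation.Binary.Construct.Closure.ReflexiveTransitive using (Star; ε; _◅_; _◅◅_)

infix 4.5 _∈ᵇ_
_∈ᵇ_ : ∀ {n} → Fin n → Subset n → Bool
x ∈ᵇ p = does (x ∈? p)

∈ᵇ-∁ : ∀ {n} x (p : Subset n) → x ∈ᵇ ∁ p ≡ not (x ∈ᵇ p)
∈ᵇ-∁ x p = does-⇔ (mk⇔ x∈∁p⇒x∉p x∉p⇒x∈∁p) (x ∈? ∁ p) (¬? (x ∈? p))

∈ᵇ≡not-∈ᵇ∁ : ∀ {n} x (p : Subset n) → x ∈ᵇ p ≡ not (x ∈ᵇ ∁ p)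
∈ᵇ≡not-∈ᵇ∁ x p = ≡.trans (≡.sym (not-involutive (x ∈ᵇ p))) (≡.cong not (≡.sym (∈ᵇ-∁ x p)))

∈ᵇ-∩ : ∀ {n} x (p q : Subset n) → x ∈ᵇ p ∩ q ≡ (x ∈ᵇ p) ∧ (x ∈ᵇ q)
∈ᵇ-∩ x p q = does-⇔ ∩⇔× (x ∈? p ∩ q) ((x ∈? p) ×-dec (x ∈? q))

∈⇒0<∣p∣ : ∀ {n x} {p : Subset n} → x ∈ p → 0 < ∣ p ∣
∈⇒0<∣p∣ x∈p = <-≤-trans (s≤s z≤n) (x∈p⇒∣p-x∣<∣p∣ x∈p)

0<∣p∣⇒nonempty : ∀ {n} {p : Subset n} → 0 < ∣ p ∣ → Nonempty p
0<∣p∣⇒nonempty {n} {p} 0<∣p∣ with nonempty? p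
... | yes nonempty = nonempty
... | no  empty    = ⊥-elim (<-irrefl (≡.sym (≡.trans (≡.cong ∣_∣ (Empty-unique empty)) (∣⊥∣≡0 n))) 0<∣p∣)

filter : ∀ {n ℓ} {P : Pred (Fin n) ℓ} → U.Decidable P → Subset n
filter P? = tabulate (does ∘ P?)

module _ {n ℓ} {P : Pred (Fin n) ℓ} (P? : U.Decidable P) where

  ∈-filter⁻ : ∀ {x} → x ∈ filter P? → P x
  ∈-filter⁻ {x} x∈ with P? x | ≡.trans (≡.sym (lookup∘tabulate (does ∘ P?) x)) ([]=⇒lookup x∈)
  ... | yes px | _ = px

  ∈-filter⁺ : ∀ {x} → P x → x ∈ filter P?
  ∈-filter⁺ {x} px =
    lookup⇒[]= x (filter P?) (≡.trans (lookup∘tabulate (does ∘ P?) x) (dec-true (P? x) px))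

  ∈ᵇ-filter : ∀ x → x ∈ᵇ filter P? ≡ does (P? x)
  ∈ᵇ-filter x = does-⇔ (mk⇔ ∈-filter⁻ ∈-filter⁺) (x ∈? filter P?) (P? x)

module _ where
  open CommutativeMonoidSum ℕ.+-0-commutativeMonoid using (sum; sum-cong-≗; sum-permute)

  ∣p∣≡sum : ∀ {n} (p : Subset n) → ∣ p ∣ ≡ sum (λ x → if x ∈ᵇ p then 1 else 0)
  ∣p∣≡sum []            = ≡.refl
  ∣p∣≡sum (inside ∷ p)  = ≡.cong suc (∣p∣≡sum p)
  ∣p∣≡sum (outside ∷ p) = ∣p∣≡sum p

  ∣preimage∣≡∣p∣ : ∀ {n} (π : Permutation n n) (p : Subset n) →
                ∣ filter (λ x → π ⟨$⟩ʳ x ∈? p) ∣ ≡ ∣ p ∣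
  ∣preimage∣≡∣p∣ π p = begin
    ∣ filter π⁻¹p? ∣
      ≡⟨ ∣p∣≡sum (filter π⁻¹p?) ⟩
    sum (λ x → if x ∈ᵇ filter π⁻¹p? then 1 else 0)
      ≡⟨ sum-cong-≗ (≡.cong (if_then 1 else 0) ∘ ∈ᵇ-filter π⁻¹p?) ⟩
    sum (λ x → if π ⟨$⟩ʳ x ∈ᵇ p then 1 else 0)
      ≡⟨ sum-permute (λ y → if y ∈ᵇ p then 1 else 0) π ⟨
    sum (λ y → if y ∈ᵇ p then 1 else 0)
      ≡⟨ ∣p∣≡sum p ⟨
    ∣ p ∣
      ∎
    where
    open ≡.≡-Reasoning
    π⁻¹p? : U.Decidable (λ x → π ⟨$⟩ʳ x ∈ p)
    π⁻¹p? x = π ⟨$⟩ʳ x ∈? p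

module Reachability {n e} {E : Rel (Fin n) e} (E? : Decidable E) where

  Closed : Subset n → Set e
  Closed X = ∀ {a b} → E a b → a ∈ X → b ∈ X

  Star-closed : ∀ {X} → Closed X → ∀ {a b} → Star E a b → a ∈ X → b ∈ X
  Star-closed closed ε       a∈X = a∈X
  Star-closed closed (e ◅ p) a∈X = Star-closed closed p (closed e a∈X)

  InExpansion : Subset n → Pred (Fin n) e
  InExpansion X y = y ∈ X ⊎ ∃ λ x → x ∈ X × E x y

  inExpansion? : ∀ X → U.Decidable (InExpansion X)
  inExpansion? X y = (y ∈? X) ⊎-dec any? (λ x → (x ∈? X) ×-dec E? x y)

  expand : Subset n → Subset n
  expand X = filter (inExpansion? X)

  ⊆-expand : ∀ X → X ⊆ expand X
  ⊆-expand X y∈X = ∈-filter⁺ (inExpansion? X) (inj₁ y∈X)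

  ⊄-expand⇒closed : ∀ X → ¬ (X ⊂ expand X) → Closed X
  ⊄-expand⇒closed X X⊄ {a} {b} e a∈X = decidable-stable (b ∈? X) λ b∉X →
    X⊄ (⊆-expand X , b , ∈-filter⁺ (inExpansion? X) (inj₂ (a , a∈X , e)) , b∉X)

  ball : Fin n → ℕ → Subset n
  ball x zero    = ⁅ x ⁆
  ball x (suc m) = expand (ball x m)

  centre∈ball : ∀ x m → x ∈ ball x m
  centre∈ball x zero    = x∈⁅x⁆ x
  centre∈ball x (suc m) = ⊆-expand (ball x m) (centre∈ball x m)

  ball⇒Star : ∀ x m {y} → y ∈ ball x m → Star E x y
  ball⇒Star x zero    y∈ with x∈⁅y⁆⇒x≡y x y∈
  ... | ≡.refl = ε
  ball⇒Star x (suc m) y∈ with ∈-filter⁻ (inExpansion? (ball x m)) y∈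
  ... | inj₁ y∈ball         = ball⇒Star x m y∈ball
  ... | inj₂ (z , z∈ , ezy) = ball⇒Star x m z∈ ◅◅ (ezy ◅ ε)

  -- A ball that is not closed is strictly contained in the next one, which cannot happen n times.
  closed-ball-or-large : ∀ x m → (∃ λ k → Closed (ball x k)) ⊎ m < ∣ ball x m ∣
  closed-ball-or-large x zero = inj₂ (∈⇒0<∣p∣ (x∈⁅x⁆ x))
  closed-ball-or-large x (suc m) with closed-ball-or-large x m
  ... | inj₁ closed = inj₁ closed
  ... | inj₂ m<∣ball∣ with ball x m ⊂? ball x (suc m)
  ...   | yes ⊂next = inj₂ (<-≤-trans (s≤s m<∣ball∣) (p⊂q⇒∣p∣<∣q∣ ⊂next))
  ...   | no  ⊄next = inj₁ (m , ⊄-expand⇒closed (ball x m) ⊄next)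

  closed-ball : ∀ x → ∃ λ k → Closed (ball x k)
  closed-ball x with closed-ball-or-large x n
  ... | inj₁ closed     = closed
  ... | inj₂ n<∣ball∣ = ⊥-elim (<-irrefl ≡.refl (<-≤-trans n<∣ball∣ (∣p∣≤n (ball x n))))

  Star? : Decidable (Star E)
  Star? x y with closed-ball x
  ... | k , closed with y ∈? ball x k
  ...   | yes y∈ = yes (ball⇒Star x k y∈)
  ...   | no  y∉ = no (λ p → y∉ (Star-closed closed p (centre∈ball x k)))

  ¬connected⇒separated : ¬ (∀ x y → Star E x y) →
    Σ (Subset n) λ X → Closed X × (∃ λ x → x ∈ X) × (∃ λ y → y ∉ X)
  ¬connected⇒separated disconnected
    with ¬∀⟶∃¬ n _ (λ x → all? (Star? x)) disconnected
  ... | x , ¬reach with ¬∀⟶∃¬ n _ (Star? x) ¬reach | closed-ball x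
  ...   | y , ¬x→y | k , closed =
    ball x k , closed , (x , centre∈ball x k) , (y , ¬x→y ∘ ball⇒Star x k)

module FieldProperties {c ℓ} (F : Field c ℓ) where

  open Field F hiding (zero)
  open import Relation.Binary.Reasoning.Setoid setoid
  open import Algebra.Properties.Ring ring using (-1*x≈-x; -‿involutive; x[y-z]≈xy-xz; [y-z]x≈yx-zx)
  open import Algebra.Properties.Group +-group using (x∙y⁻¹≈ε⇒x≈y; x≈y⇒x∙y⁻¹≈ε; inverseˡ-unique)
  open import Algebra.Properties.CommutativeSemigroup *-commutativeSemigroup using (x∙yz≈y∙xz)
  open import Algebra.Properties.Semiring.Sum semiring
    using (sum; sum-cong-≋; ∑-distrib-+; ∑-comm; sum-permute; *-distribˡ-sum)

  x*y≈0⇒y≈0 : ∀ {x y} → ¬ x ≈ 0# → x * y ≈ 0# → y ≈ 0#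
  x*y≈0⇒y≈0 {x} {y} x≉0 xy≈0 with inverse x x≉0
  ... | x⁻¹ , xx⁻¹≈1 = begin
    y              ≈⟨ *-identityˡ y ⟨
    1# * y         ≈⟨ *-congʳ (trans (*-comm x⁻¹ x) xx⁻¹≈1) ⟨
    (x⁻¹ * x) * y  ≈⟨ *-assoc x⁻¹ x y ⟩
    x⁻¹ * (x * y)  ≈⟨ *-congˡ xy≈0 ⟩
    x⁻¹ * 0#       ≈⟨ zeroʳ x⁻¹ ⟩
    0#             ∎

  *-≉0 : ∀ {x y} → ¬ x ≈ 0# → ¬ y ≈ 0# → ¬ x * y ≈ 0#
  *-≉0 x≉0 y≉0 = y≉0 ∘ x*y≈0⇒y≈0 x≉0

  *-cancelˡ-≉0 : ∀ {a x y} → ¬ a ≈ 0# → a * x ≈ a * y → x ≈ y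
  *-cancelˡ-≉0 {a} {x} {y} a≉0 ax≈ay =
    x∙y⁻¹≈ε⇒x≈y x y (x*y≈0⇒y≈0 a≉0 (trans (x[y-z]≈xy-xz a x y) (x≈y⇒x∙y⁻¹≈ε ax≈ay)))

  embed≉0 : CharZero F → ∀ {m} → 0 < m → ¬ embed F m ≈ 0#
  embed≉0 charZero {suc m} _ = charZero m

  μ²a≈κ²a⇒a≈0 : ∀ {μ κ a} → μ * (μ * a) ≈ κ * (κ * a) → ¬ μ ≈ κ → ¬ μ ≈ - κ → a ≈ 0#
  μ²a≈κ²a⇒a≈0 {μ} {κ} {a} μ²a≈κ²a μ≉κ μ≉-κ =
    x*y≈0⇒y≈0 μ+κ≉0 (x*y≈0⇒y≈0 μ-κ≉0 (trans ([y-z]x≈yx-zx b μ κ) (x≈y⇒x∙y⁻¹≈ε μb≈κb)))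
    where
    b = (μ + κ) * a
    μb≈κb : μ * b ≈ κ * b
    μb≈κb = begin
      μ * ((μ + κ) * a)            ≈⟨ *-congˡ (distribʳ a μ κ) ⟩
      μ * (μ * a + κ * a)          ≈⟨ distribˡ μ (μ * a) (κ * a) ⟩
      μ * (μ * a) + μ * (κ * a)    ≈⟨ +-cong μ²a≈κ²a (x∙yz≈y∙xz μ κ a) ⟩
      κ * (κ * a) + κ * (μ * a)    ≈⟨ distribˡ κ (κ * a) (μ * a) ⟨
      κ * (κ * a + μ * a)          ≈⟨ *-congˡ (trans (distribʳ a μ κ) (+-comm (μ * a) (κ * a))) ⟨
      κ * ((μ + κ) * a)            ∎
    μ-κ≉0 : ¬ μ - κ ≈ 0#
    μ-κ≉0 = μ≉κ ∘ x∙y⁻¹≈ε⇒x≈y μ κ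
    μ+κ≉0 : ¬ μ + κ ≈ 0#
    μ+κ≉0 = μ≉-κ ∘ inverseˡ-unique μ κ

  σ²≈1⇒σ≉0 : ∀ {σ} → σ * σ ≈ 1# → ¬ σ ≈ 0#
  σ²≈1⇒σ≉0 {σ} σ²≈1 σ≈0 = 1≉0 (trans (sym σ²≈1) (trans (*-congʳ σ≈0) (zeroˡ σ)))

  μ≈±κ⇒μ≈σκ : ∀ {μ κ} → μ ≈ κ ⊎ μ ≈ - κ → Σ Carrier λ σ → σ * σ ≈ 1# × μ ≈ σ * κ
  μ≈±κ⇒μ≈σκ (inj₁ μ≈κ)  = 1# , *-identityˡ 1# , trans μ≈κ (sym (*-identityˡ _))
  μ≈±κ⇒μ≈σκ (inj₂ μ≈-κ) = - 1# , trans (-1*x≈-x (- 1#)) (-‿involutive 1#) , trans μ≈-κ (sym (-1*x≈-x _))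

  sumFin≡sum : ∀ {n} (f : Fin n → Carrier) → sumFin F f ≡ sum f
  sumFin≡sum {zero}  f = ≡.refl
  sumFin≡sum {suc n} f = ≡.cong (f Fin.zero +_) (sumFin≡sum (f ∘ Fin.suc))

  sumFin-cong : ∀ {n} {f g : Fin n → Carrier} → (∀ x → f x ≈ g x) → sumFin F f ≈ sumFin F g
  sumFin-cong {f = f} {g} f≈g
    rewrite sumFin≡sum f | sumFin≡sum g = sum-cong-≋ f≈g

  sumFin-+ : ∀ {n} (f g : Fin n → Carrier) →
             sumFin F (λ x → f x + g x) ≈ sumFin F f + sumFin F g
  sumFin-+ f g
    rewrite sumFin≡sum (λ x → f x + g x) | sumFin≡sum f | sumFin≡sum g = ∑-distrib-+ f g

  sumFin-* : ∀ {n} a (f : Fin n → Carrier) → sumFin F (λ x → a * f x) ≈ a * sumFin F f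
  sumFin-* a f
    rewrite sumFin≡sum (λ x → a * f x) | sumFin≡sum f = sym (*-distribˡ-sum a f)

  sumFin-- : ∀ {n} (f g : Fin n → Carrier) →
             sumFin F (λ x → f x - g x) ≈ sumFin F f - sumFin F g
  sumFin-- f g = begin
    sumFin F (λ x → f x - g x)              ≈⟨ sumFin-cong (λ x → +-congˡ (-1*x≈-x (g x))) ⟨
    sumFin F (λ x → f x + - 1# * g x)       ≈⟨ sumFin-+ f (λ x → - 1# * g x) ⟩
    sumFin F f + sumFin F (λ x → - 1# * g x) ≈⟨ +-congˡ (trans (sumFin-* (- 1#) g) (-1*x≈-x _)) ⟩
    sumFin F f - sumFin F g                 ∎

  sumFin-comm : ∀ {m n} (f : Fin m → Fin n → Carrier) →
    sumFin F (λ i → sumFin F (f i)) ≈ sumFin F (λ j → sumFin F (λ i → f i j))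
  sumFin-comm f = begin
    sumFin F (λ i → sumFin F (f i))         ≡⟨ sumFin≡sum (λ i → sumFin F (f i)) ⟩
    sum (λ i → sumFin F (f i))              ≈⟨ sum-cong-≋ (λ i → reflexive (sumFin≡sum (f i))) ⟩
    sum (λ i → sum (f i))                   ≈⟨ ∑-comm f ⟩
    sum (λ j → sum (λ i → f i j))           ≈⟨ sum-cong-≋ (λ j → reflexive (sumFin≡sum (λ i → f i j))) ⟨
    sum (λ j → sumFin F (λ i → f i j))      ≡⟨ sumFin≡sum (λ j → sumFin F (λ i → f i j)) ⟨
    sumFin F (λ j → sumFin F (λ i → f i j)) ∎

  sumFin-permute : ∀ {n} (f : Fin n → Carrier) (π : Permutation n n) →
                   sumFin F (λ x → f (π ⟨$⟩ʳ x)) ≈ sumFin F f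
  sumFin-permute f π
    rewrite sumFin≡sum (λ x → f (π ⟨$⟩ʳ x)) | sumFin≡sum f = sym (sum-permute f π)

  infixr 9 [_]·_
  [_]·_ : Bool → Carrier → Carrier
  [ b ]· v = if b then v else 0#

  sumOver : ∀ {n} → Subset n → (Fin n → Carrier) → Carrier
  sumOver p f = sumFin F (λ x → [ x ∈ᵇ p ]· f x)

  infix 8 sumOver
  syntax sumOver p (λ x → e) = ∑[ x ∈ p ] e

  sumOver-cong : ∀ {n} {p : Subset n} {f g : Fin n → Carrier} →
                 (∀ {x} → x ∈ p → f x ≈ g x) → ∑[ x ∈ p ] f x ≈ ∑[ x ∈ p ] g x
  sumOver-cong {p = p} {f} {g} f≈g = sumFin-cong pointwise
    where
    pointwise : ∀ x → [ x ∈ᵇ p ]· f x ≈ [ x ∈ᵇ p ]· g x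
    pointwise x with x ∈? p
    ... | yes x∈p = f≈g x∈p
    ... | no  _   = refl

  []·-∧ : ∀ b d v → [ b ∧ d ]· v ≡ [ b ]· [ d ]· v
  []·-∧ true  d v = ≡.refl
  []·-∧ false d v = ≡.refl

  []·-comm : ∀ b d v → [ b ]· [ d ]· v ≡ [ d ]· [ b ]· v
  []·-comm true  d     v = ≡.refl
  []·-comm false true  v = ≡.refl
  []·-comm false false v = ≡.refl

  []·-sumFin : ∀ {n} b (f : Fin n → Carrier) → [ b ]· sumFin F f ≈ sumFin F (λ x → [ b ]· f x)
  []·-sumFin true  f = refl
  []·-sumFin {n} false f = begin
    0#                        ≈⟨ zeroˡ (sumFin F f) ⟨
    0# * sumFin F f           ≈⟨ sumFin-* 0# f ⟨
    sumFin F (λ x → 0# * f x) ≈⟨ sumFin-cong (λ x → zeroˡ (f x)) ⟩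
    sumFin F {n} (λ x → 0#)   ∎

  *-[]· : ∀ b {a v d w} → a * v ≈ d * w → a * [ b ]· v ≈ d * [ b ]· w
  *-[]· true  av≈dw = av≈dw
  *-[]· false {a} {d = d} _ = trans (zeroʳ a) (sym (zeroʳ d))

  sumOver-* : ∀ {n} {p : Subset n} a (f : Fin n → Carrier) →
              ∑[ x ∈ p ] (a * f x) ≈ a * ∑[ x ∈ p ] f x
  sumOver-* {p = p} a f = trans (sumFin-cong pointwise) (sumFin-* a (λ x → [ x ∈ᵇ p ]· f x))
    where
    pointwise : ∀ x → [ x ∈ᵇ p ]· (a * f x) ≈ a * [ x ∈ᵇ p ]· f x
    pointwise x with x ∈? p
    ... | yes _ = refl
    ... | no  _ = sym (zeroʳ a)

  sumOver-- : ∀ {n} {p : Subset n} (f g : Fin n → Carrier) →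
              ∑[ x ∈ p ] (f x - g x) ≈ ∑[ x ∈ p ] f x - ∑[ x ∈ p ] g x
  sumOver-- {p = p} f g =
    trans (sumFin-cong pointwise) (sumFin-- (λ x → [ x ∈ᵇ p ]· f x) (λ x → [ x ∈ᵇ p ]· g x))
    where
    pointwise : ∀ x → [ x ∈ᵇ p ]· (f x - g x) ≈ [ x ∈ᵇ p ]· f x - [ x ∈ᵇ p ]· g x
    pointwise x with x ∈? p
    ... | yes _ = refl
    ... | no  _ = sym (-‿inverseʳ 0#)

  sumOver-const : ∀ {n} (p : Subset n) a → ∑[ x ∈ p ] a ≈ embed F ∣ p ∣ * a
  sumOver-const []            a = sym (zeroˡ a)
  sumOver-const (inside ∷ p)  a = begin
    a + ∑[ x ∈ p ] a           ≈⟨ +-cong (sym (*-identityˡ a)) (sumOver-const p a) ⟩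
    1# * a + embed F ∣ p ∣ * a ≈⟨ distribʳ a 1# (embed F ∣ p ∣) ⟨
    embed F ∣ inside ∷ p ∣ * a ∎
  sumOver-const (outside ∷ p) a = trans (+-identityˡ _) (sumOver-const p a)

  sumOver-∪ : ∀ {n} {p q : Subset n} (f : Fin n → Carrier) → p ∩ q ≡ ⊥ →
              ∑[ x ∈ p ∪ q ] f x ≈ ∑[ x ∈ p ] f x + ∑[ x ∈ q ] f x
  sumOver-∪ {p = p} {q} f p∩q≡⊥ =
    trans (sumFin-cong pointwise) (sumFin-+ (λ x → [ x ∈ᵇ p ]· f x) (λ x → [ x ∈ᵇ q ]· f x))
    where
    pointwise : ∀ x → [ x ∈ᵇ p ∪ q ]· f x ≈ [ x ∈ᵇ p ]· f x + [ x ∈ᵇ q ]· f x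
    pointwise x with x ∈? p | x ∈? q | x ∈? p ∪ q
    ... | yes x∈p | yes x∈q | _       = ⊥-elim (∉⊥ (≡.subst (x ∈_) p∩q≡⊥ (x∈p∩q⁺ (x∈p , x∈q))))
    ... | yes _   | no  _   | yes _   = sym (+-identityʳ (f x))
    ... | no  _   | yes _   | yes _   = sym (+-identityˡ (f x))
    ... | no  _   | no  _   | no  _   = sym (+-identityˡ 0#)
    ... | yes x∈p | _       | no  x∉  = ⊥-elim (x∉ (x∈p∪q⁺ (inj₁ x∈p)))
    ... | no  _   | yes x∈q | no  x∉  = ⊥-elim (x∉ (x∈p∪q⁺ (inj₂ x∈q)))
    ... | no  x∉p | no  x∉q | yes x∈  = ⊥-elim ([ x∉p , x∉q ]′ (x∈p∪q⁻ p q x∈))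

  sumOver-∩ : ∀ {n} (p q : Subset n) (f : Fin n → Carrier) →
              ∑[ x ∈ p ] [ x ∈ᵇ q ]· f x ≈ ∑[ x ∈ p ∩ q ] f x
  sumOver-∩ p q f = sumFin-cong λ x →
    reflexive (≡.trans (≡.sym ([]·-∧ (x ∈ᵇ p) (x ∈ᵇ q) (f x))) (≡.cong ([_]· f x) (≡.sym (∈ᵇ-∩ x p q))))

  sumOver-permute : ∀ {n} {p q : Subset n} (π : Permutation n n) (f : Fin n → Carrier) →
                    (∀ x → x ∈ᵇ p ≡ π ⟨$⟩ʳ x ∈ᵇ q) →
                    ∑[ x ∈ p ] f (π ⟨$⟩ʳ x) ≈ ∑[ y ∈ q ] f y
  sumOver-permute {q = q} π f p≡π⁻¹q = trans
    (sumFin-cong (λ x → reflexive (≡.cong ([_]· f (π ⟨$⟩ʳ x)) (p≡π⁻¹q x))))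
    (sumFin-permute (λ y → [ y ∈ᵇ q ]· f y) π)

  sumOver-comm : ∀ {m n} {p : Subset m} {q : Subset n} (g : Fin m → Fin n → Carrier) →
                 ∑[ y ∈ p ] ∑[ s ∈ q ] g y s ≈ ∑[ s ∈ q ] ∑[ y ∈ p ] g y s
  sumOver-comm {p = p} {q} g = begin
    sumFin F (λ y → [ y ∈ᵇ p ]· sumFin F (λ s → [ s ∈ᵇ q ]· g y s))
      ≈⟨ sumFin-cong (λ y → []·-sumFin (y ∈ᵇ p) (λ s → [ s ∈ᵇ q ]· g y s)) ⟩
    sumFin F (λ y → sumFin F (λ s → [ y ∈ᵇ p ]· [ s ∈ᵇ q ]· g y s))
      ≈⟨ sumFin-comm (λ y s → [ y ∈ᵇ p ]· [ s ∈ᵇ q ]· g y s) ⟩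
    sumFin F (λ s → sumFin F (λ y → [ y ∈ᵇ p ]· [ s ∈ᵇ q ]· g y s))
      ≈⟨ sumFin-cong (λ s → sumFin-cong (λ y → reflexive ([]·-comm (y ∈ᵇ p) (s ∈ᵇ q) (g y s)))) ⟩
    sumFin F (λ s → sumFin F (λ y → [ s ∈ᵇ q ]· [ y ∈ᵇ p ]· g y s))
      ≈⟨ sumFin-cong (λ s → []·-sumFin (s ∈ᵇ q) (λ y → [ y ∈ᵇ p ]· g y s)) ⟨
    sumFin F (λ s → [ s ∈ᵇ q ]· sumFin F (λ y → [ y ∈ᵇ p ]· g y s))
      ∎

  sumOver-comm-const : ∀ {m n} {p : Subset m} {q : Subset n} (g : Fin m → Fin n → Carrier) {T} →
    (∀ {s} → s ∈ q → ∑[ y ∈ p ] g y s ≈ T) → ∑[ y ∈ p ] ∑[ s ∈ q ] g y s ≈ embed F ∣ q ∣ * T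
  sumOver-comm-const {q = q} g {T} inner≈T =
    trans (sumOver-comm g) (trans (sumOver-cong inner≈T) (sumOver-const q T))

module FinGroupProperties (G : FinGroup) where

  open FinGroup G
  open IsGroup isGroup using (_\\_; _//_)

  private
    group : Group 0ℓ 0ℓ
    group = record { isGroup = isGroup }

  open import Algebra.Properties.Group group public
    using (\\-leftDividesˡ; \\-leftDividesʳ; //-rightDividesˡ; //-rightDividesʳ; ⁻¹-involutive)
  open import Algebra.Properties.Group group using (quasigroup)
  open import Algebra.Properties.Quasigroup quasigroup using (y≈x\\z; x≈z//y)

  leftMul : Fin order → Permutation order order
  leftMul a = permutation (a ·_) (a \\_) (\\-leftDividesˡ a) (\\-leftDividesʳ a)

  rightMul : Fin order → Permutation order order
  rightMul a = permutation (_· a) (_// a) (//-rightDividesˡ a) (//-rightDividesʳ a)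

  leftDiv : Fin order → Permutation order order
  leftDiv a = permutation (a //_) (_\\ a)
    (λ t → ≡.sym (x≈z//y t (t \\ a) a (\\-leftDividesˡ t a)))
    (λ s → ≡.sym (y≈x\\z (a // s) s a (//-rightDividesˡ s a)))

module SubgroupProperties (G : FinGroup) {H : Subset (FinGroup.order G)} (H-subgroup : IsSubgroup G H) where

  open FinGroup G
  open IsGroup isGroup using (_\\_; _//_)
  open FinGroupProperties G

  ·-∈ : ∀ {x y} → x ∈ H → y ∈ H → x · y ∈ H
  ·-∈ = proj₁ (proj₂ H-subgroup) _ _

  ⁻¹-∈ : ∀ {x} → x ∈ H → x ⁻¹ ∈ H
  ⁻¹-∈ = proj₂ (proj₂ H-subgroup) _

  ⁻¹-∈⁻ : ∀ {x} → x ⁻¹ ∈ H → x ∈ H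
  ⁻¹-∈⁻ {x} x⁻¹∈H = ≡.subst (_∈ H) (⁻¹-involutive x) (⁻¹-∈ x⁻¹∈H)

  ·-∈⁻ˡ : ∀ {h x} → h ∈ H → h · x ∈ H → x ∈ H
  ·-∈⁻ˡ {h} {x} h∈H hx∈H = ≡.subst (_∈ H) (\\-leftDividesʳ h x) (·-∈ (⁻¹-∈ h∈H) hx∈H)

  ·-∈⁻ʳ : ∀ {h x} → h ∈ H → x · h ∈ H → x ∈ H
  ·-∈⁻ʳ {h} {x} h∈H xh∈H = ≡.subst (_∈ H) (//-rightDividesʳ h x) (·-∈ xh∈H (⁻¹-∈ h∈H))

  ∈ᵇ∁-⁻¹ : ∀ x → x ⁻¹ ∈ᵇ ∁ H ≡ x ∈ᵇ ∁ H
  ∈ᵇ∁-⁻¹ x rewrite ∈ᵇ-∁ (x ⁻¹) H | ∈ᵇ-∁ x H =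
    ≡.cong not (does-⇔ (mk⇔ ⁻¹-∈⁻ ⁻¹-∈) (x ⁻¹ ∈? H) (x ∈? H))

  module IndexTwo {n : ℕ} (∣H∣≡n : ∣ H ∣ ≡ n) (∣G∣≡2n : order ≡ 2 ℕ.* n) where

    ∣∁H∣≡n : ∣ ∁ H ∣ ≡ n
    ∣∁H∣≡n = begin
      ∣ ∁ H ∣               ≡⟨ ∣∁p∣≡n∸∣p∣ H ⟩
      order ℕ.∸ ∣ H ∣      ≡⟨ ≡.cong₂ ℕ._∸_ ∣G∣≡2n ∣H∣≡n ⟩
      n ℕ.+ (n ℕ.+ 0) ℕ.∸ n ≡⟨ m+n∸m≡n n (n ℕ.+ 0) ⟩
      n ℕ.+ 0               ≡⟨ ℕ.+-identityʳ n ⟩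
      n                     ∎
      where open ≡.≡-Reasoning

    -- The right coset {z | z // y ∈ H} of y ∉ H lies in ∁ H and is as large as ∁ H.
    //-∉-∉ : ∀ {x y} → x ∉ H → y ∉ H → x // y ∈ H
    //-∉-∉ {x} {y} x∉H y∉H = ∈-filter⁻ Hy? (decidable-stable (x ∈? Hy) λ x∉Hy →
      <-irrefl (≡.trans ∣Hy∣≡n (≡.sym ∣∁H∣≡n))
        (p⊂q⇒∣p∣<∣q∣ ((λ z∈Hy → x∉p⇒x∈∁p (λ z∈H → y∉H (⁻¹-∈⁻ (·-∈⁻ˡ z∈H (∈-filter⁻ Hy? z∈Hy)))))
                     , x , x∉p⇒x∈∁p x∉H , x∉Hy)))
      where
      Hy? : U.Decidable (λ z → z // y ∈ H)
      Hy? z = rightMul (y ⁻¹) ⟨$⟩ʳ z ∈? H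
      Hy = filter Hy?
      ∣Hy∣≡n : ∣ Hy ∣ ≡ n
      ∣Hy∣≡n = ≡.trans (∣preimage∣≡∣p∣ (rightMul (y ⁻¹)) H) ∣H∣≡n

    ·-∉-∉ : ∀ {x y} → x ∉ H → y ∉ H → x · y ∈ H
    ·-∉-∉ {x} {y} x∉H y∉H =
      ≡.subst (λ z → x · z ∈ H) (⁻¹-involutive y) (//-∉-∉ x∉H (y∉H ∘ ⁻¹-∈⁻))

    ∈ᵇ∁-· : ∀ x y → x · y ∈ᵇ ∁ H ≡ (x ∈ᵇ ∁ H) xor (y ∈ᵇ ∁ H)
    ∈ᵇ∁-· x y rewrite ∈ᵇ-∁ (x · y) H | ∈ᵇ-∁ x H | ∈ᵇ-∁ y H with x ∈? H | y ∈? H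
    ... | yes x∈H | yes y∈H = ≡.cong not (dec-true  (x · y ∈? H) (·-∈ x∈H y∈H))
    ... | yes x∈H | no  y∉H = ≡.cong not (dec-false (x · y ∈? H) (y∉H ∘ ·-∈⁻ˡ x∈H))
    ... | no  x∉H | yes y∈H = ≡.cong not (dec-false (x · y ∈? H) (x∉H ∘ ·-∈⁻ʳ y∈H))
    ... | no  x∉H | no  y∉H = ≡.cong not (dec-true  (x · y ∈? H) (·-∉-∉ x∉H y∉H))

    ∈ᵇ∁-∈-· : ∀ {h} x → h ∈ H → h · x ∈ᵇ ∁ H ≡ x ∈ᵇ ∁ H
    ∈ᵇ∁-∈-· {h} x h∈H =
      ≡.trans (∈ᵇ∁-· h x) (≡.cong (_xor (x ∈ᵇ ∁ H)) (dec-false (h ∈? ∁ H) (λ h∈∁H → x∈∁p⇒x∉p h∈∁H h∈H)))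

    ∈ᵇ-∉-· : ∀ {g} x → g ∉ H → g · x ∈ᵇ H ≡ x ∈ᵇ ∁ H
    ∈ᵇ-∉-· {g} x g∉H = begin
      g · x ∈ᵇ H                    ≡⟨ ∈ᵇ≡not-∈ᵇ∁ (g · x) H ⟩
      not (g · x ∈ᵇ ∁ H)            ≡⟨ ≡.cong not (∈ᵇ∁-· g x) ⟩
      not ((g ∈ᵇ ∁ H) xor (x ∈ᵇ ∁ H)) ≡⟨ ≡.cong (λ b → not (b xor (x ∈ᵇ ∁ H))) g∈ᵇ∁H ⟩
      not (not (x ∈ᵇ ∁ H))          ≡⟨ not-involutive (x ∈ᵇ ∁ H) ⟩
      x ∈ᵇ ∁ H                      ∎
      where
      open ≡.≡-Reasoning
      g∈ᵇ∁H = dec-true (g ∈? ∁ H) (x∉p⇒x∈∁p g∉H)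

    ∈ᵇ-·-∉ : ∀ {g} x → g ∉ H → x · g ∈ᵇ H ≡ x ∈ᵇ ∁ H
    ∈ᵇ-·-∉ {g} x g∉H = begin
      x · g ∈ᵇ H                      ≡⟨ ∈ᵇ≡not-∈ᵇ∁ (x · g) H ⟩
      not (x · g ∈ᵇ ∁ H)              ≡⟨ ≡.cong not (∈ᵇ∁-· x g) ⟩
      not ((x ∈ᵇ ∁ H) xor (g ∈ᵇ ∁ H)) ≡⟨ ≡.cong (λ b → not ((x ∈ᵇ ∁ H) xor b)) g∈ᵇ∁H ⟩
      not ((x ∈ᵇ ∁ H) xor true)       ≡⟨ not-distribʳ-xor (x ∈ᵇ ∁ H) true ⟩
      (x ∈ᵇ ∁ H) xor false            ≡⟨ xor-identityʳ (x ∈ᵇ ∁ H) ⟩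
      x ∈ᵇ ∁ H                        ∎
      where
      open ≡.≡-Reasoning
      g∈ᵇ∁H = dec-true (g ∈? ∁ H) (x∉p⇒x∈∁p g∉H)

    ∈ᵇ∁-·-∉ : ∀ {g} x → g ∉ H → x · g ∈ᵇ ∁ H ≡ x ∈ᵇ H
    ∈ᵇ∁-·-∉ {g} x g∉H = begin
      x · g ∈ᵇ ∁ H      ≡⟨ ∈ᵇ-∁ (x · g) H ⟩
      not (x · g ∈ᵇ H)  ≡⟨ ≡.cong not (∈ᵇ-·-∉ x g∉H) ⟩
      not (x ∈ᵇ ∁ H)    ≡⟨ ∈ᵇ≡not-∈ᵇ∁ x H ⟨
      x ∈ᵇ H            ∎
      where open ≡.≡-Reasoning

module Adjacency {c ℓ} (F : Field c ℓ) (G : FinGroup)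
                 {H : Subset (FinGroup.order G)} (H-subgroup : IsSubgroup G H) where

  open Field F hiding (zero)
  open FinGroup G
  open IsGroup isGroup using (_//_)
  open FieldProperties F
  open FinGroupProperties G
  open SubgroupProperties G H-subgroup
  open import Relation.Binary.Reasoning.Setoid setoid
  open import Algebra.Properties.Ring ring using (-‿distribˡ-*; x[y-z]≈xy-xz; -0#≈0#)
  open import Algebra.Properties.Group +-group using (inverseʳ-unique; x≈y⇒x∙y⁻¹≈ε)
  open import Algebra.Properties.CommutativeSemigroup *-commutativeSemigroup using (x∙yz≈y∙xz)

  A : Subset order → (Fin order → Carrier) → Fin order → Carrier
  A = adj F G H

  EigenEquation : Subset order → (Fin order → Carrier) → Carrier → Set ℓ
  EigenEquation S f μ = ∀ y → A S f y ≈ μ * f y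

  CosetSumsVanish : (Fin order → Carrier) → Set ℓ
  CosetSumsVanish f = ∑[ x ∈ H ] f x ≈ 0# × ∑[ x ∈ ∁ H ] f x ≈ 0#

  LinkedEigenpair : Subset order → Subset order → Carrier → Set (c ⊔ ℓ)
  LinkedEigenpair S T μ =
    Σ (Fin order → Carrier) λ f → Σ (Fin order → Carrier) λ g →
      IsEigenfunction F G H S f μ × IsEigenfunction F G H S g μ × LinearlyIndependent₂ F G f g
      × IsEigenfunction F G H T (λ x → f x - g x) (- μ)

  Edge-sym : ∀ {S x y} → Edge G H S x y → Edge G H S y x
  Edge-sym (inj₁ e) = inj₂ e
  Edge-sym (inj₂ e) = inj₁ e

  Edge? : ∀ S → Decidable (Edge G H S)
  Edge? S x y = ((x ∈? H) ×-dec any? (λ s → (s ∈? S) ×-dec (y ≟ x · s)))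
         ⊎-dec ((y ∈? H) ×-dec any? (λ s → (s ∈? S) ×-dec (x ≟ y · s)))

  module Graph S = Reachability (Edge? S)

  closed-∈ᵇ : ∀ {S X a b} → Graph.Closed S X → Edge G H S a b → a ∈ᵇ X ≡ b ∈ᵇ X
  closed-∈ᵇ {X = X} {a} {b} closed e = does-⇔ (mk⇔ (closed e) (closed (Edge-sym e))) (a ∈? X) (b ∈? X)

  ∁-closed : ∀ {S X} → Graph.Closed S X → Graph.Closed S (∁ X)
  ∁-closed closed e a∈∁X = x∉p⇒x∈∁p (x∈∁p⇒x∉p a∈∁X ∘ closed (Edge-sym e))

  signedIndicator : Subset order → Carrier → Fin order → Carrier
  signedIndicator X σ x = [ x ∈ᵇ X ]· (if x ∈ᵇ H then 1# else σ)

  signedIndicator-∈H : ∀ X σ {x} → x ∈ H → signedIndicator X σ x ≡ [ x ∈ᵇ X ]· 1#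
  signedIndicator-∈H X σ {x} x∈H =
    ≡.cong (λ b → [ x ∈ᵇ X ]· (if b then 1# else σ)) (dec-true (x ∈? H) x∈H)

  signedIndicator-∉H : ∀ X σ {x} → x ∉ H → signedIndicator X σ x ≡ [ x ∈ᵇ X ]· σ
  signedIndicator-∉H X σ {x} x∉H =
    ≡.cong (λ b → [ x ∈ᵇ X ]· (if b then 1# else σ)) (dec-false (x ∈? H) x∉H)

  signedIndicator-≉0 : ∀ {X σ x} → ¬ σ ≈ 0# → x ∈ X → ¬ signedIndicator X σ x ≈ 0#
  signedIndicator-≉0 {X} {σ} {x} σ≉0 x∈X
    rewrite dec-true (x ∈? X) x∈X with x ∈? H
  ... | yes _ = 1≉0
  ... | no  _ = σ≉0

  signedIndicator-∉ : ∀ {X σ x} → x ∉ X → signedIndicator X σ x ≈ 0#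
  signedIndicator-∉ {X} {x = x} x∉X rewrite dec-false (x ∈? X) x∉X = refl

  separated⇒linearlyIndependent₂ : ∀ {f g x y} → ¬ f x ≈ 0# → g x ≈ 0# → f y ≈ 0# → ¬ g y ≈ 0# →
                                   LinearlyIndependent₂ F G f g
  separated⇒linearlyIndependent₂ {f} {g} {x} {y} fx≉0 gx≈0 fy≈0 gy≉0 a b af+bg≈0 =
    x*y≈0⇒y≈0 fx≉0 (trans (*-comm (f x) a) (begin
      a * f x              ≈⟨ +-identityʳ (a * f x) ⟨
      a * f x + 0#         ≈⟨ +-congˡ (trans (*-congˡ gx≈0) (zeroʳ b)) ⟨
      a * f x + b * g x    ≈⟨ af+bg≈0 x ⟩
      0#                   ∎)) ,
    x*y≈0⇒y≈0 gy≉0 (trans (*-comm (g y) b) (begin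
      b * g y              ≈⟨ +-identityˡ (b * g y) ⟨
      0# + b * g y         ≈⟨ +-congʳ (trans (*-congˡ fy≈0) (zeroʳ a)) ⟨
      a * f y + b * g y    ≈⟨ af+bg≈0 y ⟩
      0#                   ∎))

  adj-∈ : ∀ S f {y} → y ∈ H → A S f y ≡ ∑[ s ∈ S ] f (y · s)
  adj-∈ S f {y} y∈H with y ∈? H
  ... | yes _   = ≡.refl
  ... | no  y∉H = ⊥-elim (y∉H y∈H)

  adj-∉ : ∀ S f {y} → y ∉ H → A S f y ≡ ∑[ s ∈ S ] f (y // s)
  adj-∉ S f {y} y∉H with y ∈? H
  ... | yes y∈H = ⊥-elim (y∉H y∈H)
  ... | no  _   = ≡.refl

  adj-* : ∀ S a f y → A S (λ x → a * f x) y ≈ a * A S f y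
  adj-* S a f y with y ∈? H
  ... | yes _ = sumOver-* a (λ s → f (y · s))
  ... | no  _ = sumOver-* a (λ s → f (y // s))

  adj-- : ∀ S f g y → A S (λ x → f x - g x) y ≈ A S f y - A S g y
  adj-- S f g y with y ∈? H
  ... | yes _ = sumOver-- (λ s → f (y · s)) (λ s → g (y · s))
  ... | no  _ = sumOver-- (λ s → f (y // s)) (λ s → g (y // s))

  adj-∪ : ∀ {S T} f y → S ∩ T ≡ ⊥ → A (S ∪ T) f y ≈ A S f y + A T f y
  adj-∪ f y S∩T≡⊥ with y ∈? H
  ... | yes _ = sumOver-∪ (λ s → f (y · s)) S∩T≡⊥
  ... | no  _ = sumOver-∪ (λ s → f (y // s)) S∩T≡⊥

  EigenEquation-* : ∀ {S f μ} a → EigenEquation S f μ → EigenEquation S (λ x → a * f x) μ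
  EigenEquation-* {S} {f} {μ} a eigen y = begin
    A S (λ x → a * f x) y  ≈⟨ adj-* S a f y ⟩
    a * A S f y            ≈⟨ *-congˡ (eigen y) ⟩
    a * (μ * f y)          ≈⟨ x∙yz≈y∙xz a μ (f y) ⟩
    μ * (a * f y)          ∎

  EigenEquation-- : ∀ {S f g μ} → EigenEquation S f μ → EigenEquation S g μ →
                    EigenEquation S (λ x → f x - g x) μ
  EigenEquation-- {S} {f} {g} {μ} eigen-f eigen-g y = begin
    A S (λ x → f x - g x) y  ≈⟨ adj-- S f g y ⟩
    A S f y - A S g y        ≈⟨ +-cong (eigen-f y) (-‿cong (eigen-g y)) ⟩
    μ * f y - μ * g y        ≈⟨ x[y-z]≈xy-xz μ (f y) (g y) ⟨
    μ * (f y - g y)          ∎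

  sameRatio⇒cosetSumsVanish : ∀ {u v σ} →
    ∑[ x ∈ ∁ H ] u x ≈ σ * ∑[ x ∈ H ] u x → ∑[ x ∈ ∁ H ] v x ≈ σ * ∑[ x ∈ H ] v x →
    CosetSumsVanish (λ x → ∑[ y ∈ H ] v y * u x - ∑[ y ∈ H ] u y * v x)
  sameRatio⇒cosetSumsVanish {u} {v} {σ} ∑∁H-u ∑∁H-v =
    trans (combination H) (x≈y⇒x∙y⁻¹≈ε (*-comm α β)) ,
    trans (combination (∁ H)) (x≈y⇒x∙y⁻¹≈ε (begin
      α * ∑[ x ∈ ∁ H ] u x  ≈⟨ *-congˡ ∑∁H-u ⟩
      α * (σ * β)           ≈⟨ x∙yz≈y∙xz α σ β ⟩
      σ * (α * β)           ≈⟨ *-congˡ (*-comm α β) ⟩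
      σ * (β * α)           ≈⟨ x∙yz≈y∙xz β σ α ⟨
      β * (σ * α)           ≈⟨ *-congˡ ∑∁H-v ⟨
      β * ∑[ x ∈ ∁ H ] v x  ∎))
    where
    α = ∑[ y ∈ H ] v y
    β = ∑[ y ∈ H ] u y
    combination : ∀ p → ∑[ x ∈ p ] (α * u x - β * v x) ≈ α * ∑[ x ∈ p ] u x - β * ∑[ x ∈ p ] v x
    combination p = trans (sumOver-- (λ x → α * u x) (λ x → β * v x))
                          (+-cong (sumOver-* α u) (-‿cong (sumOver-* β v)))

  μ*sumOver≈sumOver-adj : ∀ {S f μ} p → EigenEquation S f μ → μ * ∑[ y ∈ p ] f y ≈ ∑[ y ∈ p ] A S f y
  μ*sumOver≈sumOver-adj {S} {f} {μ} p eigen =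
    trans (sym (sumOver-* μ f)) (sumOver-cong (λ {y} _ → sym (eigen y)))

  module IndexTwoGraph {n : ℕ} (∣H∣≡n : ∣ H ∣ ≡ n) (∣G∣≡2n : order ≡ 2 ℕ.* n) where

    open IndexTwo ∣H∣≡n ∣G∣≡2n

    adj-∁H-∈ : ∀ f {y} → y ∈ H → A (∁ H) f y ≈ ∑[ x ∈ ∁ H ] f x
    adj-∁H-∈ f {y} y∈H = trans (reflexive (adj-∈ (∁ H) f y∈H))
      (sumOver-permute (leftMul y) f (λ s → ≡.sym (∈ᵇ∁-∈-· s y∈H)))

    adj-∁H-∉ : ∀ f {y} → y ∉ H → A (∁ H) f y ≈ ∑[ x ∈ H ] f x
    adj-∁H-∉ f {y} y∉H = trans (reflexive (adj-∉ (∁ H) f y∉H))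
      (sumOver-permute (leftDiv y) f (λ s → ≡.sym (≡.trans (∈ᵇ-∉-· (s ⁻¹) y∉H) (∈ᵇ∁-⁻¹ s))))

    -- Double counting the edges between H and ∁ H.
    eigen-sumOver-H : ∀ {S f μ} → S ⊆ ∁ H → EigenEquation S f μ →
                      μ * ∑[ x ∈ H ] f x ≈ embed F ∣ S ∣ * ∑[ x ∈ ∁ H ] f x
    eigen-sumOver-H {S} {f} {μ} S⊆∁H eigen = begin
      μ * ∑[ x ∈ H ] f x                ≈⟨ μ*sumOver≈sumOver-adj H eigen ⟩
      ∑[ y ∈ H ] A S f y                ≈⟨ sumOver-cong (λ y∈H → reflexive (adj-∈ S f y∈H)) ⟩
      ∑[ y ∈ H ] ∑[ s ∈ S ] f (y · s)   ≈⟨ sumOver-comm-const (λ y s → f (y · s)) translate ⟩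
      embed F ∣ S ∣ * ∑[ x ∈ ∁ H ] f x  ∎
      where
      translate : ∀ {s} → s ∈ S → ∑[ y ∈ H ] f (y · s) ≈ ∑[ x ∈ ∁ H ] f x
      translate {s} s∈S =
        sumOver-permute (rightMul s) f (λ y → ≡.sym (∈ᵇ∁-·-∉ y (x∈∁p⇒x∉p (S⊆∁H s∈S))))

    eigen-sumOver-∁H : ∀ {S f μ} → S ⊆ ∁ H → EigenEquation S f μ →
                       μ * ∑[ x ∈ ∁ H ] f x ≈ embed F ∣ S ∣ * ∑[ x ∈ H ] f x
    eigen-sumOver-∁H {S} {f} {μ} S⊆∁H eigen = begin
      μ * ∑[ x ∈ ∁ H ] f x                 ≈⟨ μ*sumOver≈sumOver-adj (∁ H) eigen ⟩
      ∑[ y ∈ ∁ H ] A S f y                 ≈⟨ sumOver-cong (reflexive ∘ adj-∉ S f ∘ x∈∁p⇒x∉p) ⟩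
      ∑[ y ∈ ∁ H ] ∑[ s ∈ S ] f (y // s)   ≈⟨ sumOver-comm-const (λ y s → f (y // s)) translate ⟩
      embed F ∣ S ∣ * ∑[ x ∈ H ] f x       ∎
      where
      translate : ∀ {s} → s ∈ S → ∑[ y ∈ ∁ H ] f (y // s) ≈ ∑[ x ∈ H ] f x
      translate {s} s∈S = sumOver-permute (rightMul (s ⁻¹)) f λ y →
        ≡.sym (∈ᵇ-·-∉ y (x∈∁p⇒x∉p (S⊆∁H s∈S) ∘ ⁻¹-∈⁻))

    eigen-complement : ∀ {S T f μ} → S ∪ T ≡ ∁ H → S ∩ T ≡ ⊥ →
                       EigenEquation S f μ → CosetSumsVanish f → EigenEquation T f (- μ)
    eigen-complement {S} {T} {f} {μ} S∪T≡∁H S∩T≡⊥ eigen (∑H≈0 , ∑∁H≈0) y = begin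
      A T f y        ≈⟨ inverseʳ-unique (A S f y) (A T f y) (begin
                          A S f y + A T f y  ≈⟨ adj-∪ f y S∩T≡⊥ ⟨
                          A (S ∪ T) f y      ≡⟨ ≡.cong (λ U → A U f y) S∪T≡∁H ⟩
                          A (∁ H) f y        ≈⟨ adj-∁H≈0 ⟩
                          0#                 ∎) ⟩
      - A S f y      ≈⟨ -‿cong (eigen y) ⟩
      - (μ * f y)    ≈⟨ -‿distribˡ-* μ (f y) ⟩
      - μ * f y      ∎
      where
      adj-∁H≈0 : A (∁ H) f y ≈ 0#
      adj-∁H≈0 = [ (λ y∈H → trans (adj-∁H-∈ f y∈H) ∑∁H≈0) , (λ y∉H → trans (adj-∁H-∉ f y∉H) ∑H≈0) ]′
                   (toSum (y ∈? H))

    signedIndicator-eigen : ∀ {S X σ} → S ⊆ ∁ H → Graph.Closed S X → σ * σ ≈ 1# →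
                            EigenEquation S (signedIndicator X σ) (σ * embed F ∣ S ∣)
    signedIndicator-eigen {S} {X} {σ} S⊆∁H closed σ²≈1 y = [ on-H , off-H ]′ (toSum (y ∈? H))
      where
      u = signedIndicator X σ
      κ = embed F ∣ S ∣
      s∉H : ∀ {s} → s ∈ S → s ∉ H
      s∉H = x∈∁p⇒x∉p ∘ S⊆∁H

      on-H : y ∈ H → A S u y ≈ (σ * κ) * u y
      on-H y∈H = begin
        A S u y                     ≡⟨ adj-∈ S u y∈H ⟩
        ∑[ s ∈ S ] u (y · s)        ≈⟨ sumOver-cong (reflexive ∘ neighbour) ⟩
        ∑[ s ∈ S ] [ y ∈ᵇ X ]· σ    ≈⟨ sumOver-const S ([ y ∈ᵇ X ]· σ) ⟩
        κ * [ y ∈ᵇ X ]· σ           ≈⟨ *-[]· (y ∈ᵇ X) (trans (*-comm κ σ) (sym (*-identityʳ (σ * κ)))) ⟩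
        (σ * κ) * [ y ∈ᵇ X ]· 1#    ≡⟨ ≡.cong ((σ * κ) *_) (signedIndicator-∈H X σ y∈H) ⟨
        (σ * κ) * u y               ∎
        where
        neighbour : ∀ {s} → s ∈ S → u (y · s) ≡ [ y ∈ᵇ X ]· σ
        neighbour {s} s∈S = ≡.trans (signedIndicator-∉H X σ (s∉H s∈S ∘ ·-∈⁻ˡ y∈H))
          (≡.cong ([_]· σ) (≡.sym (closed-∈ᵇ closed (inj₁ (y∈H , s , s∈S , ≡.refl)))))

      off-H : y ∉ H → A S u y ≈ (σ * κ) * u y
      off-H y∉H = begin
        A S u y                     ≡⟨ adj-∉ S u y∉H ⟩
        ∑[ s ∈ S ] u (y // s)       ≈⟨ sumOver-cong (reflexive ∘ neighbour) ⟩
        ∑[ s ∈ S ] [ y ∈ᵇ X ]· 1#   ≈⟨ sumOver-const S ([ y ∈ᵇ X ]· 1#) ⟩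
        κ * [ y ∈ᵇ X ]· 1#          ≈⟨ *-[]· (y ∈ᵇ X) κ≈σκσ ⟩
        (σ * κ) * [ y ∈ᵇ X ]· σ     ≡⟨ ≡.cong ((σ * κ) *_) (signedIndicator-∉H X σ y∉H) ⟨
        (σ * κ) * u y               ∎
        where
        neighbour : ∀ {s} → s ∈ S → u (y // s) ≡ [ y ∈ᵇ X ]· 1#
        neighbour {s} s∈S = ≡.trans (signedIndicator-∈H X σ y//s∈H)
          (≡.cong ([_]· 1#) (closed-∈ᵇ closed (inj₁ (y//s∈H , s , s∈S , ≡.sym (//-rightDividesˡ s y)))))
          where y//s∈H = //-∉-∉ y∉H (s∉H s∈S)
        κ≈σκσ : κ * 1# ≈ (σ * κ) * σ
        κ≈σκσ = begin
          κ * 1#        ≈⟨ *-congˡ σ²≈1 ⟨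
          κ * (σ * σ)   ≈⟨ *-assoc κ σ σ ⟨
          (κ * σ) * σ   ≈⟨ *-congʳ (*-comm κ σ) ⟩
          (σ * κ) * σ   ∎

    closed-meets-H : ∀ {S X x} → Nonempty S → S ⊆ ∁ H → Graph.Closed S X → x ∈ X →
                     ∃ λ z → z ∈ H ∩ X
    closed-meets-H {x = x} (s , s∈S) S⊆∁H closed x∈X with x ∈? H
    ... | yes x∈H = x , x∈p∩q⁺ (x∈H , x∈X)
    ... | no  x∉H = x // s , x∈p∩q⁺ (x//s∈H , closed (inj₂ (x//s∈H , s , s∈S , x≡x//s·s)) x∈X)
      where
      x//s∈H = //-∉-∉ x∉H (x∈∁p⇒x∉p (S⊆∁H s∈S))
      x≡x//s·s = ≡.sym (//-rightDividesˡ s x)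

    ∑H-signedIndicator≉0 : ∀ {S X σ x} → CharZero F → Nonempty S → S ⊆ ∁ H → Graph.Closed S X →
                           x ∈ X → ¬ ∑[ y ∈ H ] signedIndicator X σ y ≈ 0#
    ∑H-signedIndicator≉0 {X = X} {σ} charZero S≢∅ S⊆∁H closed x∈X ∑≈0
      with closed-meets-H S≢∅ S⊆∁H closed x∈X
    ... | z , z∈H∩X = embed≉0 charZero (∈⇒0<∣p∣ z∈H∩X) (begin
      embed F ∣ H ∩ X ∣                  ≈⟨ *-identityʳ (embed F ∣ H ∩ X ∣) ⟨
      embed F ∣ H ∩ X ∣ * 1#             ≈⟨ sumOver-const (H ∩ X) 1# ⟨
      ∑[ y ∈ H ∩ X ] 1#                  ≈⟨ sumOver-∩ H X (λ _ → 1#) ⟨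
      ∑[ y ∈ H ] [ y ∈ᵇ X ]· 1#          ≈⟨ sumOver-cong (reflexive ∘ ≡.sym ∘ signedIndicator-∈H X σ) ⟩
      ∑[ y ∈ H ] signedIndicator X σ y   ≈⟨ ∑≈0 ⟩
      0#                                 ∎)

    ∑∁H-signedIndicator : ∀ {S X σ} → ¬ embed F ∣ S ∣ ≈ 0# → S ⊆ ∁ H → Graph.Closed S X → σ * σ ≈ 1# →
      ∑[ x ∈ ∁ H ] signedIndicator X σ x ≈ σ * ∑[ x ∈ H ] signedIndicator X σ x
    ∑∁H-signedIndicator {S} {X} {σ} κ≉0 S⊆∁H closed σ²≈1 = sym (*-cancelˡ-≉0 κ≉0 (begin
      κ * (σ * ∑H)  ≈⟨ x∙yz≈y∙xz κ σ ∑H ⟩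
      σ * (κ * ∑H)  ≈⟨ *-assoc σ κ ∑H ⟨
      (σ * κ) * ∑H  ≈⟨ eigen-sumOver-H S⊆∁H (signedIndicator-eigen S⊆∁H closed σ²≈1) ⟩
      κ * ∑∁H       ∎))
      where
      κ = embed F ∣ S ∣
      ∑H = ∑[ x ∈ H ] signedIndicator X σ x
      ∑∁H = ∑[ x ∈ ∁ H ] signedIndicator X σ x

    module Splitting (charZero : CharZero F) {S T : Subset order}
             (S∪T≡∁H : S ∪ T ≡ ∁ H) (S∩T≡⊥ : S ∩ T ≡ ⊥) (0<∣S∣ : 0 < ∣ S ∣) where

      private
        κ = embed F ∣ S ∣

        κ≉0 : ¬ κ ≈ 0#
        κ≉0 = embed≉0 charZero 0<∣S∣

        S⊆∁H : S ⊆ ∁ H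
        S⊆∁H s∈S = ≡.subst (_ ∈_) S∪T≡∁H (x∈p∪q⁺ (inj₁ s∈S))

      eigen-≉±κ⇒eigen-complement : ∀ {f μ} → IsEigenfunction F G H S f μ → ¬ μ ≈ κ → ¬ μ ≈ - κ →
                                   IsEigenfunction F G H T f (- μ)
      eigen-≉±κ⇒eigen-complement {f} {μ} (f≢0 , eigen) μ≉κ μ≉-κ =
        f≢0 , eigen-complement S∪T≡∁H S∩T≡⊥ eigen (vanish ∑H-eq ∑∁H-eq , vanish ∑∁H-eq ∑H-eq)
        where
        ∑H-eq = eigen-sumOver-H S⊆∁H eigen
        ∑∁H-eq = eigen-sumOver-∁H S⊆∁H eigen
        vanish : ∀ {a b} → μ * a ≈ κ * b → μ * b ≈ κ * a → a ≈ 0#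
        vanish {a} {b} μa≈κb μb≈κa = μ²a≈κ²a⇒a≈0 (begin
          μ * (μ * a)  ≈⟨ *-congˡ μa≈κb ⟩
          μ * (κ * b)  ≈⟨ x∙yz≈y∙xz μ κ b ⟩
          κ * (μ * b)  ≈⟨ *-congˡ μb≈κa ⟩
          κ * (κ * a)  ∎) μ≉κ μ≉-κ

      separated⇒linkedEigenpair : ∀ {C x₀ y₀ σ μ} → Graph.Closed S C → x₀ ∈ C → y₀ ∉ C →
                                  σ * σ ≈ 1# → μ ≈ σ * κ → LinkedEigenpair S T μ
      separated⇒linkedEigenpair {C} {x₀} {y₀} {σ} {μ} closed x₀∈C y₀∉C σ²≈1 μ≈σκ =
        f , g , ((λ f≈0 → fx₀≉0 (f≈0 x₀)) , eigen-f) , ((λ g≈0 → gy₀≉0 (g≈0 y₀)) , eigen-g) ,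
        separated⇒linearlyIndependent₂ {x = x₀} {y₀} fx₀≉0 gx₀≈0 fy₀≈0 gy₀≉0 ,
        ((λ f-g≈0 → fx₀≉0 (trans (sym f-g≈f) (f-g≈0 x₀))) ,
         eigen-complement S∪T≡∁H S∩T≡⊥ (EigenEquation-- eigen-f eigen-g)
           (sameRatio⇒cosetSumsVanish (ratio closed) (ratio (∁-closed closed))))
        where
        u = signedIndicator C σ
        v = signedIndicator (∁ C) σ
        α = ∑[ y ∈ H ] v y
        β = ∑[ y ∈ H ] u y
        f g : Fin order → Carrier
        f x = α * u x
        g x = β * v x

        ratio : ∀ {X} → Graph.Closed S X →
                ∑[ x ∈ ∁ H ] signedIndicator X σ x ≈ σ * ∑[ x ∈ H ] signedIndicator X σ x
        ratio closedX = ∑∁H-signedIndicator κ≉0 S⊆∁H closedX σ²≈1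

        eigen : ∀ {X} → Graph.Closed S X → EigenEquation S (signedIndicator X σ) μ
        eigen closedX y = trans (signedIndicator-eigen S⊆∁H closedX σ²≈1 y) (*-congʳ (sym μ≈σκ))

        eigen-f : EigenEquation S f μ
        eigen-f = EigenEquation-* α (eigen closed)
        eigen-g : EigenEquation S g μ
        eigen-g = EigenEquation-* β (eigen (∁-closed closed))

        y₀∈∁C : y₀ ∈ ∁ C
        y₀∈∁C = x∉p⇒x∈∁p y₀∉C

        fx₀≉0 : ¬ f x₀ ≈ 0#
        fx₀≉0 = *-≉0 (∑H-signedIndicator≉0 charZero (0<∣p∣⇒nonempty 0<∣S∣) S⊆∁H (∁-closed closed) y₀∈∁C)
                     (signedIndicator-≉0 (σ²≈1⇒σ≉0 σ²≈1) x₀∈C)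
        gy₀≉0 : ¬ g y₀ ≈ 0#
        gy₀≉0 = *-≉0 (∑H-signedIndicator≉0 charZero (0<∣p∣⇒nonempty 0<∣S∣) S⊆∁H closed x₀∈C)
                     (signedIndicator-≉0 (σ²≈1⇒σ≉0 σ²≈1) y₀∈∁C)
        gx₀≈0 : g x₀ ≈ 0#
        gx₀≈0 = trans (*-congˡ (signedIndicator-∉ (λ x₀∈∁C → x∈∁p⇒x∉p x₀∈∁C x₀∈C))) (zeroʳ β)
        fy₀≈0 : f y₀ ≈ 0#
        fy₀≈0 = trans (*-congˡ (signedIndicator-∉ y₀∉C)) (zeroʳ α)

        f-g≈f : f x₀ - g x₀ ≈ f x₀
        f-g≈f = trans (+-congˡ (trans (-‿cong gx₀≈0) -0#≈0#)) (+-identityʳ (f x₀))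

      disconnected⇒linkedEigenpair : ∀ {μ} → ¬ Connected G H S → μ ≈ κ ⊎ μ ≈ - κ →
                                     LinkedEigenpair S T μ
      disconnected⇒linkedEigenpair disconnected μ≈±κ
        with Graph.¬connected⇒separated S disconnected | μ≈±κ⇒μ≈σκ μ≈±κ
      ... | C , closed , (x₀ , x₀∈C) , (y₀ , y₀∉C) | σ , σ²≈1 , μ≈σκ =
        separated⇒linkedEigenpair closed x₀∈C y₀∉C σ²≈1 μ≈σκ

open import Data.Nat using (_*_; _∸_)

theorem4p5 : ∀ {c ℓ} (F : Field c ℓ) → CharZero F →
    (G : FinGroup) (H S₁ S₂ : Subset (FinGroup.order G)) (n k : ℕ) →
    IsSubgroup G H → ∣ H ∣ ≡ n → FinGroup.order G ≡ 2 * n →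
    S₁ ∪ S₂ ≡ ∁ H → S₁ ∩ S₂ ≡ ⊥ →
    ∣ S₁ ∣ ≡ k → ∣ S₂ ∣ ≡ n ∸ k → 0 < k → k < n →
    (¬ Connected G H S₁ →
      ∀ μ → Field._≈_ F μ (embed F k) ⊎ Field._≈_ F μ (Field.-_ F (embed F k)) →
      Σ (Fin (FinGroup.order G) → Field.Carrier F) λ f →
      Σ (Fin (FinGroup.order G) → Field.Carrier F) λ g →
        IsEigenfunction F G H S₁ f μ × IsEigenfunction F G H S₁ g μ
        × LinearlyIndependent₂ F G f g
        × IsEigenfunction F G H S₂ (λ x → Field._-_ F (f x) (g x)) (Field.-_ F μ))
    × (∀ (f : Fin (FinGroup.order G) → Field.Carrier F) μ →
        IsEigenfunction F G H S₁ f μ →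
        ¬ Field._≈_ F μ (embed F k) → ¬ Field._≈_ F μ (Field.-_ F (embed F k)) →
        IsEigenfunction F G H S₂ f (Field.-_ F μ))
theorem4p5 F charZero G H S₁ S₂ n k H-subgroup ∣H∣≡n ∣G∣≡2n S₁∪S₂≡∁H S₁∩S₂≡⊥ ≡.refl _ 0<k _ =
  (λ disconnected μ → disconnected⇒linkedEigenpair disconnected) ,
  (λ f μ → eigen-≉±κ⇒eigen-complement)
  where open Adjacency.IndexTwoGraph.Splitting F G H-subgroup ∣H∣≡n ∣G∣≡2n charZero S₁∪S₂≡∁H S₁∩S₂≡⊥ 0<k
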